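{- Let $G=(V,E)$ be a bipartite graph with parts $V_1=\{v_1,\ldots,v_{n_1}\}$ and $V_2=\{v'_1,\ldots,v'_{n_2}\}$, $n_1\le n_2$, $E\subseteq V_1\times V_2$, in which maximum matchings have size $t\le n_1$, and suppose $M:=\{(v_1,v'_1),\ldots,(v_t,v'_t)\}$ is a maximum matching of $G$. Then: (1) $G$ has no edge $(v_i,v'_j)$ with $i>t$ and $j>t$ (no lower edge connects two lower nodes); (2) every lower edge of $G$ is allowed.
   Context: A matching is a set of pairwise non-adjacent edges; a maximum matching is one of largest cardinality; an edge is allowed if it belongs to some maximum matching. A node $v_i$ or $v'_i$ is called upper (with respect to $M$) if $i\le t$ and lower if $i>t$. An edge $(v_i,v'_j)$ is an upper edge if both endpoints are upper nodes (i.e. $i,j\le t$); all other edges are lower edges. -}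

module Defs where

open import Data.Nat using (ℕ; _≤_; _<_)
open import Data.Fin using (Fin; toℕ; inject≤)
open import Data.List using (List; map; length; allFin)
open import Data.List.Relation.Unary.All using (All)
open import Data.List.Relation.Unary.Unique.Propositional using (Unique)
open import Data.List.Membership.Propositional using (_∈_)
open import Data.Product using (_×_; _,_; proj₁; proj₂; ∃-syntax)
open import Data.Sum using (_⊎_)

-- A bipartite graph with parts V₁ = Fin n₁ (nodes v_i) and V₂ = Fin n₂
-- (nodes v'_j) is given by its edge relation E ⊆ V₁ × V₂.
-- Indices are 0-based: paper's v_i is (i-1) here.

Edge : ℕ → ℕ → Set
Edge n₁ n₂ = Fin n₁ × Fin n₂

-- A matching: a finite set of edges of G that are pairwise non-adjacent,
-- represented as a list of edges whose left endpoints are pairwise distinct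
-- and whose right endpoints are pairwise distinct (hence also no repeated
-- edges, so the length is the cardinality).
IsMatching : {n₁ n₂ : ℕ} → (Fin n₁ → Fin n₂ → Set) → List (Edge n₁ n₂) → Set
IsMatching E m =
  All (λ e → E (proj₁ e) (proj₂ e)) m × Unique (map proj₁ m) × Unique (map proj₂ m)

IsMaximumMatching : {n₁ n₂ : ℕ} → (Fin n₁ → Fin n₂ → Set) → List (Edge n₁ n₂) → Set
IsMaximumMatching E m =
  IsMatching E m × (∀ m′ → IsMatching E m′ → length m′ ≤ length m)

Allowed : {n₁ n₂ : ℕ} → (Fin n₁ → Fin n₂ → Set) → Edge n₁ n₂ → Set
Allowed E e = ∃[ m ] (IsMaximumMatching E m × e ∈ m)

-- The matching M = {(v_1,v'_1),…,(v_t,v'_t)} (0-based: pairs (k,k), k < t).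
diagMatching : {n₁ n₂ : ℕ} (t : ℕ) → t ≤ n₁ → t ≤ n₂ → List (Edge n₁ n₂)
diagMatching t t≤n₁ t≤n₂ = map (λ k → inject≤ k t≤n₁ , inject≤ k t≤n₂) (allFin t)

-- Upper / lower nodes w.r.t. M (0-based: upper iff index < t).
Upper : {n : ℕ} → ℕ → Fin n → Set
Upper t i = toℕ i < t

Lower : {n : ℕ} → ℕ → Fin n → Set
Lower t i = t ≤ toℕ i

LowerEdge : {n₁ n₂ : ℕ} → ℕ → Edge n₁ n₂ → Set
LowerEdge t (i , j) = Lower t i ⊎ Lower t j

-- Adding an edge between two lower nodes to M would give a matching larger
-- than the maximum, which proves (1).  By (1), a lower edge (v_i, v'_j) has
-- exactly one lower endpoint, say v_i; then v'_j is matched by (v_j, v'_j) ∈ M,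
-- and exchanging that edge for (v_i, v'_j) yields a matching of size t, hence a
-- maximum one containing (v_i, v'_j).  The case of a lower v'_j is symmetric.
module Submission where

open import Defs
open import Data.Empty using (⊥-elim)
open import Data.Fin using (Fin; toℕ; inject≤; fromℕ<)
open import Data.Fin.Properties using (toℕ-injective; toℕ-inject≤; toℕ-fromℕ<; toℕ<n)
open import Data.List using (List; _∷_; _++_; map; length)
open import Data.List.Membership.Propositional using (_∈_; _∉_)
open import Data.List.Membership.Propositional.Properties using (∈-∃++; ∈-map⁺; ∈-map⁻; ∈-allFin)
open import Data.List.Relation.Binary.Permutation.Propositional using (_↭_; ↭-sym; ↭⇒↭ₛ)
open import Data.List.Relation.Binary.Permutation.Propositional.Properties
  using (All-resp-↭; ∈-resp-↭; map⁺; ↭-length; shift)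
open import Data.List.Relation.Binary.Permutation.Setoid.Properties using (Unique-resp-↭)
open import Data.List.Relation.Unary.All using (_∷_)
open import Data.List.Relation.Unary.All.Properties using (¬Any⇒All¬)
open import Data.List.Relation.Unary.AllPairs using (_∷_)
open import Data.List.Relation.Unary.Any using (here; there)
open import Data.List.Relation.Unary.Unique.Propositional using (Unique)
open import Data.List.Relation.Unary.Unique.Propositional.Properties using (Unique[x∷xs]⇒x∉xs)
open import Data.Nat using (ℕ; _≤_; _<_; _≤?_)
open import Data.Nat.Properties using (n≮n; ≤-trans; ≤-reflexive; ≤⇒≯; ≰⇒>)
open import Data.Product using (_×_; _,_; proj₁; proj₂; ∃-syntax)
open import Data.Sum using (_⊎_; inj₁; inj₂)
open import Function using (_∘_)
open import Relation.Binary.PropositionalEquality using (_≡_; refl; sym; trans; subst)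
open import Relation.Binary.PropositionalEquality.Properties using (setoid)
open import Relation.Nullary using (¬_; yes; no)

inject≤-fromℕ< : ∀ {t n} (i : Fin n) (i<t : toℕ i < t) (t≤n : t ≤ n) →
                 inject≤ (fromℕ< i<t) t≤n ≡ i
inject≤-fromℕ< i i<t t≤n =
  toℕ-injective (trans (toℕ-inject≤ (fromℕ< i<t) t≤n) (toℕ-fromℕ< i<t))

upper-inject≤ : ∀ {t n} (k : Fin t) (t≤n : t ≤ n) → Upper t (inject≤ k t≤n)
upper-inject≤ {t} k t≤n = subst (_< t) (sym (toℕ-inject≤ k t≤n)) (toℕ<n k)

lower⊎upper : ∀ {n} t (k : Fin n) → Lower t k ⊎ Upper t k
lower⊎upper t k with t ≤? toℕ k
... | yes lo = inj₁ lo
... | no ¬lo = inj₂ (≰⇒> ¬lo)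

module _ {A : Set} where

  ∈⇒↭∷ : ∀ {x : A} {xs} → x ∈ xs → ∃[ rest ] xs ↭ x ∷ rest
  ∈⇒↭∷ x∈xs with ys , zs , refl ← ∈-∃++ x∈xs = ys ++ zs , shift _ ys zs

  module _ {B : Set} (f : A → B) where

    Unique-map-resp-↭ : ∀ {xs ys} → xs ↭ ys → Unique (map f xs) → Unique (map f ys)
    Unique-map-resp-↭ σ = Unique-resp-↭ (setoid B) (↭⇒↭ₛ (map⁺ f σ))

    ∉-map-rest : ∀ {x xs rest y} → xs ↭ x ∷ rest → Unique (map f xs) →
                 y ≡ f x ⊎ y ∉ map f xs → y ∉ map f rest
    ∉-map-rest σ u (inj₁ refl) = Unique[x∷xs]⇒x∉xs (Unique-map-resp-↭ σ u)
    ∉-map-rest σ u (inj₂ y∉xs) = y∉xs ∘ ∈-resp-↭ (map⁺ f (↭-sym σ)) ∘ there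

module _ {n₁ n₂ : ℕ} {E : Fin n₁ → Fin n₂ → Set} where

  IsMatching-resp-↭ : ∀ {m m′} → m ↭ m′ → IsMatching E m → IsMatching E m′
  IsMatching-resp-↭ σ (edges , u₁ , u₂) =
    All-resp-↭ σ edges , Unique-map-resp-↭ proj₁ σ u₁ , Unique-map-resp-↭ proj₂ σ u₂

  ∷-isMatching : ∀ {i j m} → E i j → i ∉ map proj₁ m → j ∉ map proj₂ m →
                 IsMatching E m → IsMatching E ((i , j) ∷ m)
  ∷-isMatching eij i∉m j∉m (edges , u₁ , u₂) =
    eij ∷ edges , ¬Any⇒All¬ _ i∉m ∷ u₁ , ¬Any⇒All¬ _ j∉m ∷ u₂

  isMatching-∷⁻ : ∀ {e m} → IsMatching E (e ∷ m) → IsMatching E m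
  isMatching-∷⁻ (_ ∷ edges , _ ∷ u₁ , _ ∷ u₂) = edges , u₁ , u₂

  isMaximumMatching⇒¬isMatching-∷ : ∀ {e m} → IsMaximumMatching E m → ¬ IsMatching E (e ∷ m)
  isMaximumMatching⇒¬isMatching-∷ (_ , maximal) e∷m = n≮n _ (maximal _ e∷m)

  isMaximumMatching-≥ : ∀ {m m′} → IsMaximumMatching E m → IsMatching E m′ →
                        length m ≤ length m′ → IsMaximumMatching E m′
  isMaximumMatching-≥ (_ , maximal) m′-matching m≤m′ =
    m′-matching , λ m″ m″-matching → ≤-trans (maximal m″ m″-matching) m≤m′

  exchange-allowed : ∀ {m e i j} → IsMaximumMatching E m → e ∈ m → E i j →
                     i ≡ proj₁ e ⊎ i ∉ map proj₁ m → j ≡ proj₂ e ⊎ j ∉ map proj₂ m →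
                     Allowed E (i , j)
  exchange-allowed {i = i} {j} max@(m-matching@(_ , u₁ , u₂) , _) e∈m eij i-free j-free
    with rest , σ ← ∈⇒↭∷ e∈m =
    (i , j) ∷ rest , isMaximumMatching-≥ max exchanged (≤-reflexive (↭-length σ)) , here refl
    where
    exchanged : IsMatching E ((i , j) ∷ rest)
    exchanged = ∷-isMatching eij (∉-map-rest proj₁ σ u₁ i-free) (∉-map-rest proj₂ σ u₂ j-free)
                  (isMatching-∷⁻ (IsMatching-resp-↭ σ m-matching))

module Diagonal {n₁ n₂ t : ℕ} (t≤n₁ : t ≤ n₁) (t≤n₂ : t ≤ n₂) where

  M : List (Edge n₁ n₂)
  M = diagMatching t t≤n₁ t≤n₂

  diagEdge : Fin t → Edge n₁ n₂
  diagEdge k = inject≤ k t≤n₁ , inject≤ k t≤n₂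

  diagEdge∈M : ∀ k → diagEdge k ∈ M
  diagEdge∈M k = ∈-map⁺ diagEdge (∈-allFin k)

  lower∉M₁ : ∀ {i} → Lower t i → i ∉ map proj₁ M
  lower∉M₁ lo i∈M
    with _ , e∈M , refl ← ∈-map⁻ proj₁ i∈M
    with k , _ , refl ← ∈-map⁻ diagEdge e∈M = ≤⇒≯ lo (upper-inject≤ k t≤n₁)

  lower∉M₂ : ∀ {j} → Lower t j → j ∉ map proj₂ M
  lower∉M₂ lo j∈M
    with _ , e∈M , refl ← ∈-map⁻ proj₂ j∈M
    with k , _ , refl ← ∈-map⁻ diagEdge e∈M = ≤⇒≯ lo (upper-inject≤ k t≤n₂)

  module _ {E : Fin n₁ → Fin n₂ → Set} (M-max : IsMaximumMatching E M) where

    no-lower-lower-edge : ∀ i j → Lower t i → Lower t j → ¬ E i j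
    no-lower-lower-edge i j lo-i lo-j eij =
      isMaximumMatching⇒¬isMatching-∷ M-max (∷-isMatching eij (lower∉M₁ lo-i) (lower∉M₂ lo-j) (proj₁ M-max))

    lower-edge-allowed : ∀ i j → E i j → LowerEdge t (i , j) → Allowed E (i , j)
    lower-edge-allowed i j eij (inj₁ lo-i) with lower⊎upper t j
    ... | inj₁ lo-j = ⊥-elim (no-lower-lower-edge i j lo-i lo-j eij)
    ... | inj₂ j<t = exchange-allowed M-max (diagEdge∈M (fromℕ< j<t)) eij
                       (inj₂ (lower∉M₁ lo-i)) (inj₁ (sym (inject≤-fromℕ< j j<t t≤n₂)))
    lower-edge-allowed i j eij (inj₂ lo-j) with lower⊎upper t i
    ... | inj₁ lo-i = ⊥-elim (no-lower-lower-edge i j lo-i lo-j eij)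
    ... | inj₂ i<t = exchange-allowed M-max (diagEdge∈M (fromℕ< i<t)) eij
                       (inj₁ (sym (inject≤-fromℕ< i i<t t≤n₁))) (inj₂ (lower∉M₂ lo-j))

proposition5 : (n₁ n₂ : ℕ) → n₁ ≤ n₂ → (E : Fin n₁ → Fin n₂ → Set) →
    (t : ℕ) → (t≤n₁ : t ≤ n₁) → (t≤n₂ : t ≤ n₂) →
    IsMaximumMatching E (diagMatching t t≤n₁ t≤n₂) →
    ((i : Fin n₁) (j : Fin n₂) → Lower t i → Lower t j → ¬ E i j)
    × ((i : Fin n₁) (j : Fin n₂) → E i j → LowerEdge t (i , j) → Allowed E (i , j))
proposition5 _ _ _ _ _ t≤n₁ t≤n₂ M-max =
  no-lower-lower-edge M-max , lower-edge-allowed M-max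
  where open Diagonal t≤n₁ t≤n₂
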